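{- Let $G=(V,E)$ be a finite, simple, undirected graph, and for $v\in V$ let $N(v)$ denote the open neighborhood of $v$. Consider the integer linear program \[ \min\ 2\sum_{v\in V} q_v + \sum_{v\in V} r_v \] subject to, for every $v\in V$: \[ q_v+\tfrac12\sum_{u\in N(v)} q_u+\tfrac12\sum_{u\in N(v)} r_u\ \ge 1,\qquad r_v\le q_v,\qquad q_v,r_v\in\{0,1\}. \] Then the optimal objective value of this program equals the double Roman domination number $\gamma_{dR}(G)$.
   Context: A double Roman dominating function (DRDF) on a graph $G=(V,E)$ is a function $f:V\to\{0,1,2,3\}$ such that: if $f(v)=0$ then $v$ has at least two neighbors $u$ with $f(u)=2$ or at least one neighbor $u$ with $f(u)=3$; and if $f(v)=1$ then $v$ has at least one neighbor $u$ with $f(u)\ge 2$. The weight of $f$ is $\sum_{v\in V} f(v)$, and the double Roman domination number $\gamma_{dR}(G)$ is the minimum weight of a DRDF on $G$. -}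

module Defs where

open import Data.Nat using (ℕ; zero; suc; _+_; _*_; _≤_)
open import Data.Fin using (Fin; zero; suc)
open import Data.Bool using (Bool; true; false; if_then_else_)
open import Data.Product using (Σ; ∃; ∃-syntax; _×_; _,_)
open import Data.Sum using (_⊎_)
open import Relation.Binary.PropositionalEquality using (_≡_; _≢_)

record SimpleGraph (n : ℕ) : Set where
  field
    Adj    : Fin n → Fin n → Bool
    sym    : ∀ u v → Adj u v ≡ Adj v u
    irrefl : ∀ v → Adj v v ≡ false

open SimpleGraph public

Adjacent : ∀ {n} → SimpleGraph n → Fin n → Fin n → Set
Adjacent G v u = Adj G v u ≡ true

sumFin : ∀ {n} → (Fin n → ℕ) → ℕ
sumFin {zero}  f = 0
sumFin {suc n} f = f zero + sumFin (λ i → f (suc i))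

⟦_⟧ : Bool → ℕ
⟦ true ⟧ = 1
⟦ false ⟧ = 0

nbrSum : ∀ {n} → SimpleGraph n → (Fin n → Bool) → Fin n → ℕ
nbrSum G x v = sumFin (λ u → if Adj G v u then ⟦ x u ⟧ else 0)

IsDRDF : ∀ {n} → SimpleGraph n → (Fin n → ℕ) → Set
IsDRDF {n} G f =
  (∀ v → f v ≤ 3) ×
  (∀ v → f v ≡ 0 →
     (∃[ u ] ∃[ w ] (u ≢ w × Adjacent G v u × Adjacent G v w × f u ≡ 2 × f w ≡ 2))
     ⊎ (∃[ u ] (Adjacent G v u × f u ≡ 3))) ×
  (∀ v → f v ≡ 1 → ∃[ u ] (Adjacent G v u × 2 ≤ f u))

weight : ∀ {n} → (Fin n → ℕ) → ℕ
weight f = sumFin f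

DRDFWeight : ∀ {n} → SimpleGraph n → ℕ → Set
DRDFWeight G k = ∃[ f ] (IsDRDF G f × weight f ≡ k)

-- The integer linear program (q_v, r_v ∈ {0,1} encoded as Bool)
-- Constraint  q_v + ½Σ_{N(v)} q_u + ½Σ_{N(v)} r_u ≥ 1  is stated
-- multiplied by 2 (exactly equivalent over the nonnegative integers).

Feasible : ∀ {n} → SimpleGraph n → (Fin n → Bool) → (Fin n → Bool) → Set
Feasible G q r =
  (∀ v → 2 ≤ 2 * ⟦ q v ⟧ + nbrSum G q v + nbrSum G r v) ×
  (∀ v → ⟦ r v ⟧ ≤ ⟦ q v ⟧)

objective : ∀ {n} → (Fin n → Bool) → (Fin n → Bool) → ℕ
objective q r = 2 * sumFin (λ v → ⟦ q v ⟧) + sumFin (λ v → ⟦ r v ⟧)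

ILPValue : ∀ {n} → SimpleGraph n → ℕ → Set
ILPValue G k = ∃[ q ] ∃[ r ] (Feasible G q r × objective q r ≡ k)

IsMinimum : (ℕ → Set) → ℕ → Set
IsMinimum P k = P k × (∀ m → P m → k ≤ m)

IsDoubleRomanDominationNumber : ∀ {n} → SimpleGraph n → ℕ → Set
IsDoubleRomanDominationNumber G k = IsMinimum (DRDFWeight G) k

IsILPOptimum : ∀ {n} → SimpleGraph n → ℕ → Set
IsILPOptimum G k = IsMinimum (ILPValue G) k

module Submission where

-- A feasible point (q, r) gives the labelling 2q + r of the same weight, and the
-- constraints say exactly that this labelling is double Roman dominating.
-- Conversely a DRDF f without label 1 is 2q + r for q = [f ≥ 2], r = [f = 3].
-- Labels 1 can be removed without increasing the weight: if f v = 1, pick a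
-- neighbour u with f u ≥ 2 and relabel v ↦ 0, u ↦ 3; this lowers the number of
-- 1-labels.  So every ILP value is a DRDF weight and every DRDF weight is at
-- least some ILP value; the ILP, having finitely many points, attains its
-- minimum, which is therefore also the least DRDF weight.

open import Defs hiding (sym)
open import Data.Bool using (Bool; true; false; if_then_else_)
open import Data.Fin using (Fin; zero; suc)
open import Data.Fin.Properties using (all?; any?; suc-injective) renaming (_≟_ to _≟ᶠ_)
open import Data.Fin.Subset.Properties using (anySubset?)
open import Data.Nat using (ℕ; zero; suc; _+_; _*_; _≤_; _<_; z≤n; s≤s; _≤ᵇ_; _≡ᵇ_; _≤?_)
import Data.Nat as ℕ
open import Data.Nat.Induction using (<-rec)
open import Data.Nat.Properties
  using (+-commutativeSemigroup; +-assoc; +-comm; +-identityʳ; *-distribˡ-+; *-zeroʳ; ≤-refl; ≤-trans;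
         ≤-reflexive; m≤m+n; m≤n+m; +-mono-≤; +-monoʳ-≤; +-cancelʳ-≤; ≮⇒≥; n<1+n; anyUpTo?;
         module ≤-Reasoning)
open import Algebra.Properties.CommutativeSemigroup +-commutativeSemigroup
  using (interchange; xy∙z≈zy∙x; xy∙z≈xz∙y)
open import Data.Product using (∃-syntax; _×_; _,_)
open import Data.Sum using (_⊎_; inj₁; inj₂)
open import Data.Vec using (tabulate; lookup)
open import Data.Vec.Properties using (lookup∘tabulate)
open import Data.Vec.Functional using (updateAt)
open import Data.Vec.Functional.Properties using (updateAt-updates; updateAt-minimal)
open import Function using (_∘_; const)
open import Relation.Nullary using (Dec; yes; no; contradiction)
open import Relation.Nullary.Decidable using (_×-dec_; map′)
open import Relation.Binary.PropositionalEquality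
  using (_≡_; _≢_; _≗_; refl; sym; trans; cong; cong₂; subst; subst₂; module ≡-Reasoning)

sumFin-cong : ∀ {n} {f g : Fin n → ℕ} → f ≗ g → sumFin f ≡ sumFin g
sumFin-cong {zero}  f≗g = refl
sumFin-cong {suc n} f≗g = cong₂ _+_ (f≗g zero) (sumFin-cong (f≗g ∘ suc))

sumFin-+ : ∀ {n} (f g : Fin n → ℕ) → sumFin (λ i → f i + g i) ≡ sumFin f + sumFin g
sumFin-+ {zero}  f g = refl
sumFin-+ {suc n} f g =
  trans (cong (f zero + g zero +_) (sumFin-+ (f ∘ suc) (g ∘ suc)))
        (interchange (f zero) (g zero) _ _)

sumFin-* : ∀ {n} c (f : Fin n → ℕ) → sumFin (λ i → c * f i) ≡ c * sumFin f
sumFin-* {zero}  c f = sym (*-zeroʳ c)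
sumFin-* {suc n} c f =
  trans (cong (c * f zero +_) (sumFin-* c (f ∘ suc))) (sym (*-distribˡ-+ c _ _))

≤-sumFin : ∀ {n} (f : Fin n → ℕ) i → f i ≤ sumFin f
≤-sumFin f zero    = m≤m+n _ _
≤-sumFin f (suc i) = ≤-trans (≤-sumFin (f ∘ suc) i) (m≤n+m _ _)

+-≤-sumFin : ∀ {n} (f : Fin n → ℕ) {i j} → i ≢ j → f i + f j ≤ sumFin f
+-≤-sumFin f {zero}  {zero}  i≢j = contradiction refl i≢j
+-≤-sumFin f {zero}  {suc j} i≢j = +-monoʳ-≤ (f zero) (≤-sumFin (f ∘ suc) j)
+-≤-sumFin f {suc i} {zero}  i≢j =
  subst (_≤ sumFin f) (+-comm (f zero) (f (suc i))) (+-monoʳ-≤ (f zero) (≤-sumFin (f ∘ suc) i))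
+-≤-sumFin f {suc i} {suc j} i≢j =
  ≤-trans (+-≤-sumFin (f ∘ suc) (i≢j ∘ cong suc)) (m≤n+m _ _)

sumFin-positive : ∀ {n} (f : Fin n → ℕ) → 1 ≤ sumFin f → ∃[ i ] 1 ≤ f i
sumFin-positive {suc n} f 1≤sum with f zero in f0
... | suc _ = zero , subst (1 ≤_) (sym f0) (s≤s z≤n)
... | zero  = let i , 1≤fi = sumFin-positive (f ∘ suc) 1≤sum in suc i , 1≤fi

sumFin-≥2 : ∀ {n} (f : Fin n → ℕ) → (∀ i → f i ≤ 1) → 2 ≤ sumFin f →
            ∃[ i ] ∃[ j ] (i ≢ j × 1 ≤ f i × 1 ≤ f j)
sumFin-≥2 {suc n} f f≤1 2≤sum with f zero in f0
... | zero =
  let i , j , i≢j , 1≤fi , 1≤fj = sumFin-≥2 (f ∘ suc) (f≤1 ∘ suc) 2≤sum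
  in suc i , suc j , i≢j ∘ suc-injective , 1≤fi , 1≤fj
sumFin-≥2 {suc n} f f≤1 (s≤s 1≤sum) | suc zero =
  let j , 1≤fj = sumFin-positive (f ∘ suc) 1≤sum
  in zero , suc j , (λ ()) , subst (1 ≤_) (sym f0) ≤-refl , 1≤fj
sumFin-≥2 {suc n} f f≤1 2≤sum | suc (suc _) with s≤s () ← subst (_≤ 1) f0 (f≤1 zero)

sumFin-updateAt : ∀ {n} {A : Set} (h : A → ℕ) (xs : Fin n → A) i (g : A → A) →
                  sumFin (h ∘ updateAt xs i g) + h (xs i) ≡ sumFin (h ∘ xs) + h (g (xs i))
sumFin-updateAt {suc n} h xs zero    g = xy∙z≈zy∙x (h (g (xs zero))) _ (h (xs zero))
sumFin-updateAt {suc n} h xs (suc i) g =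
  trans (+-assoc (h (xs zero)) _ _)
        (trans (cong (h (xs zero) +_) (sumFin-updateAt h (xs ∘ suc) i g))
               (sym (+-assoc (h (xs zero)) _ _)))

minimum : {P : ℕ → Set} → (∀ k → Dec (P k)) → ∀ {b} → P b → ∃[ k ] IsMinimum P k
minimum {P} P? {b} = <-rec (λ b → P b → ∃[ k ] IsMinimum P k) search b
  where
  search : ∀ b → (∀ {c} → c < b → P c → ∃[ k ] IsMinimum P k) → P b → ∃[ k ] IsMinimum P k
  search b below pb with anyUpTo? P? b
  ... | yes (c , c<b , pc) = below c<b pc
  ... | no  none           = b , pb , λ m pm → ≮⇒≥ λ m<b → none (m , m<b , pm)

IsMinimum-transfer : {P Q : ℕ → Set} {k : ℕ} →
                     (∀ {m} → P m → Q m) → (∀ {m} → Q m → ∃[ j ] (P j × j ≤ m)) →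
                     IsMinimum P k → IsMinimum Q k
IsMinimum-transfer P⇒Q Q⇒P (pk , least) =
  P⇒Q pk , λ m qm → let j , pj , j≤m = Q⇒P qm in ≤-trans (least j pj) j≤m

fromILP : ∀ {n} → (Fin n → Bool) → (Fin n → Bool) → Fin n → ℕ
fromILP q r v = 2 * ⟦ q v ⟧ + ⟦ r v ⟧

weight-fromILP : ∀ {n} (q r : Fin n → Bool) → weight (fromILP q r) ≡ objective q r
weight-fromILP q r =
  trans (sumFin-+ (λ v → 2 * ⟦ q v ⟧) (λ v → ⟦ r v ⟧)) (cong (_+ _) (sumFin-* 2 (λ v → ⟦ q v ⟧)))

label≤3 : ∀ a b → 2 * ⟦ a ⟧ + ⟦ b ⟧ ≤ 3
label≤3 true  true  = ≤-refl
label≤3 true  false = s≤s (s≤s z≤n)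
label≤3 false true  = s≤s z≤n
label≤3 false false = z≤n

label≢1 : ∀ {a b} → ⟦ b ⟧ ≤ ⟦ a ⟧ → 2 * ⟦ a ⟧ + ⟦ b ⟧ ≢ 1
label≢1 {true}  {true}  _ ()
label≢1 {true}  {false} _ ()
label≢1 {false} {false} _ ()

label≡0⇒false : ∀ a b → 2 * ⟦ a ⟧ + ⟦ b ⟧ ≡ 0 → a ≡ false
label≡0⇒false false b _ = refl

label≡2 : ∀ {a b} → a ≡ true → b ≡ false → 2 * ⟦ a ⟧ + ⟦ b ⟧ ≡ 2
label≡2 refl refl = refl

label≡3 : ∀ {a b} → ⟦ b ⟧ ≤ ⟦ a ⟧ → b ≡ true → 2 * ⟦ a ⟧ + ⟦ b ⟧ ≡ 3
label≡3 {true} _ refl = refl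

decode-label : ∀ {x} → x ≤ 3 → x ≢ 1 → 2 * ⟦ 2 ≤ᵇ x ⟧ + ⟦ x ≡ᵇ 3 ⟧ ≡ x
decode-label {0} _ _    = refl
decode-label {1} _ x≢1  = contradiction refl x≢1
decode-label {2} _ _    = refl
decode-label {3} _ _    = refl
decode-label {suc (suc (suc (suc _)))} (s≤s (s≤s (s≤s ()))) _

≡ᵇ3≤≤ᵇ2 : ∀ x → ⟦ x ≡ᵇ 3 ⟧ ≤ ⟦ 2 ≤ᵇ x ⟧
≡ᵇ3≤≤ᵇ2 3                           = ≤-refl
≡ᵇ3≤≤ᵇ2 0                           = z≤n
≡ᵇ3≤≤ᵇ2 1                           = z≤n
≡ᵇ3≤≤ᵇ2 2                           = z≤n
≡ᵇ3≤≤ᵇ2 (suc (suc (suc (suc _))))   = z≤n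

objective-decode : ∀ {n} {f : Fin n → ℕ} → (∀ v → f v ≤ 3) → (∀ v → f v ≢ 1) →
                   objective (λ v → 2 ≤ᵇ f v) (λ v → f v ≡ᵇ 3) ≡ weight f
objective-decode {f = f} ≤3 no-ones =
  trans (sym (weight-fromILP (λ v → 2 ≤ᵇ f v) (λ v → f v ≡ᵇ 3)))
        (sumFin-cong λ v → decode-label (≤3 v) (no-ones v))

Defended₀ : ∀ {n} → SimpleGraph n → (Fin n → ℕ) → Fin n → Set
Defended₀ G f v =
  (∃[ u ] ∃[ w ] (u ≢ w × Adjacent G v u × Adjacent G v w × f u ≡ 2 × f w ≡ 2))
  ⊎ (∃[ u ] (Adjacent G v u × f u ≡ 3))

Defended₁ : ∀ {n} → SimpleGraph n → (Fin n → ℕ) → Fin n → Set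
Defended₁ G f v = ∃[ u ] (Adjacent G v u × 2 ≤ f u)

≥2-≢-1 : ∀ {n} (f : Fin n → ℕ) {u v} → 2 ≤ f u → f v ≡ 1 → u ≢ v
≥2-≢-1 f 2≤fu fu≡1 refl with s≤s () ← subst (2 ≤_) fu≡1 2≤fu

reassign : ∀ {n} → (Fin n → ℕ) → Fin n → Fin n → Fin n → ℕ
reassign f v u = updateAt (updateAt f v (const 0)) u (const 3)

sumFin-reassign : ∀ {n} (h : ℕ → ℕ) (f : Fin n → ℕ) {v u} → u ≢ v →
                  sumFin (h ∘ reassign f v u) + h (f u) + h (f v) ≡ sumFin (h ∘ f) + h 0 + h 3
sumFin-reassign h f {v} {u} u≢v = begin
  sumFin (h ∘ reassign f v u) + h (f u) + h (f v)
    ≡⟨ cong (λ x → sumFin (h ∘ reassign f v u) + h x + h (f v))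
            (sym (updateAt-minimal u v f u≢v)) ⟩
  sumFin (h ∘ reassign f v u) + h (f₀ u) + h (f v)
    ≡⟨ cong (_+ h (f v)) (sumFin-updateAt h f₀ u (const 3)) ⟩
  sumFin (h ∘ f₀) + h 3 + h (f v)
    ≡⟨ xy∙z≈xz∙y (sumFin (h ∘ f₀)) (h 3) (h (f v)) ⟩
  sumFin (h ∘ f₀) + h (f v) + h 3
    ≡⟨ cong (_+ h 3) (sumFin-updateAt h f v (const 0)) ⟩
  sumFin (h ∘ f) + h 0 + h 3 ∎
  where
  open ≡-Reasoning
  f₀ = updateAt f v (const 0)

ones : ∀ {n} → (Fin n → ℕ) → ℕ
ones f = sumFin (λ v → ⟦ f v ≡ᵇ 1 ⟧)

weight-reassign : ∀ {n} (f : Fin n → ℕ) {v u} → f v ≡ 1 → 2 ≤ f u → weight (reassign f v u) ≤ weight f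
weight-reassign f {v} {u} fv≡1 2≤fu = +-cancelʳ-≤ 3 _ _ (begin
  weight (reassign f v u) + 3             ≤⟨ +-monoʳ-≤ (weight (reassign f v u))
                                                       (+-mono-≤ 2≤fu (≤-reflexive (sym fv≡1))) ⟩
  weight (reassign f v u) + (f u + f v)   ≡⟨ sym (+-assoc (weight (reassign f v u)) (f u) (f v)) ⟩
  weight (reassign f v u) + f u + f v     ≡⟨ sumFin-reassign (λ x → x) f (≥2-≢-1 f 2≤fu fv≡1) ⟩
  weight f + 0 + 3                        ≡⟨ cong (_+ 3) (+-identityʳ (weight f)) ⟩
  weight f + 3                            ∎)
  where open ≤-Reasoning

ones-reassign : ∀ {n} (f : Fin n → ℕ) {v u} → f v ≡ 1 → 2 ≤ f u → ones (reassign f v u) < ones f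
ones-reassign f {v} {u} fv≡1 2≤fu = begin-strict
  ones (reassign f v u)                                   <⟨ n<1+n _ ⟩
  1 + ones (reassign f v u)                               ≡⟨ +-comm 1 _ ⟩
  ones (reassign f v u) + 1                               ≡⟨ cong (_+ 1) (sym (+-identityʳ _)) ⟩
  ones (reassign f v u) + 0 + 1                           ≡⟨ cong₂ (λ a b → ones (reassign f v u) + a + b)
                                                                   (sym (≥2⇒≡ᵇ1-false 2≤fu))
                                                                   (cong (λ x → ⟦ x ≡ᵇ 1 ⟧) (sym fv≡1)) ⟩
  ones (reassign f v u) + ⟦ f u ≡ᵇ 1 ⟧ + ⟦ f v ≡ᵇ 1 ⟧     ≡⟨ sumFin-reassign (λ x → ⟦ x ≡ᵇ 1 ⟧) f (≥2-≢-1 f 2≤fu fv≡1) ⟩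
  ones f + 0 + 0                                          ≡⟨ +-identityʳ _ ⟩
  ones f + 0                                              ≡⟨ +-identityʳ _ ⟩
  ones f                                                  ∎
  where
  open ≤-Reasoning
  ≥2⇒≡ᵇ1-false : ∀ {x} → 2 ≤ x → ⟦ x ≡ᵇ 1 ⟧ ≡ 0
  ≥2⇒≡ᵇ1-false (s≤s (s≤s _)) = refl

module _ {n : ℕ} (G : SimpleGraph n) where

  nbrTerm : (Fin n → Bool) → Fin n → Fin n → ℕ
  nbrTerm x v u = if Adj G v u then ⟦ x u ⟧ else 0

  nbrTerm-≤1 : ∀ x v u → nbrTerm x v u ≤ 1
  nbrTerm-≤1 x v u with Adj G v u | x u
  ... | true  | true  = ≤-refl
  ... | true  | false = z≤n
  ... | false | _     = z≤n

  nbrTerm-positive : ∀ x v u → 1 ≤ nbrTerm x v u → Adjacent G v u × x u ≡ true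
  nbrTerm-positive x v u 1≤term with Adj G v u | x u
  ... | true  | true  = refl , refl
  ... | true  | false with () ← 1≤term
  ... | false | _     with () ← 1≤term

  nbrTerm-≡1 : ∀ {x v u} → Adjacent G v u → x u ≡ true → nbrTerm x v u ≡ 1
  nbrTerm-≡1 vu xu rewrite vu | xu = refl

  nbr⇒nbrSum-positive : ∀ {x v u} → Adjacent G v u → x u ≡ true → 1 ≤ nbrSum G x v
  nbr⇒nbrSum-positive {x} {v} {u} vu xu =
    subst (_≤ nbrSum G x v) (nbrTerm-≡1 {x} vu xu) (≤-sumFin (nbrTerm x v) u)

  nbrs⇒nbrSum-≥2 : ∀ {x v u w} → u ≢ w → Adjacent G v u → Adjacent G v w →
                   x u ≡ true → x w ≡ true → 2 ≤ nbrSum G x v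
  nbrs⇒nbrSum-≥2 {x} {v} u≢w vu vw xu xw =
    subst₂ (λ a b → a + b ≤ nbrSum G x v) (nbrTerm-≡1 {x} vu xu) (nbrTerm-≡1 {x} vw xw)
      (+-≤-sumFin (nbrTerm x v) u≢w)

  nbrSum-positive : ∀ {x v} → 1 ≤ nbrSum G x v → ∃[ u ] (Adjacent G v u × x u ≡ true)
  nbrSum-positive {x} {v} 1≤sum =
    let u , 1≤term = sumFin-positive (nbrTerm x v) 1≤sum in u , nbrTerm-positive x v u 1≤term

  nbrSum-≥2 : ∀ {x v} → 2 ≤ nbrSum G x v →
              ∃[ u ] ∃[ w ] (u ≢ w × Adjacent G v u × Adjacent G v w × x u ≡ true × x w ≡ true)
  nbrSum-≥2 {x} {v} 2≤sum =
    let u , w , u≢w , 1≤tu , 1≤tw = sumFin-≥2 (nbrTerm x v) (nbrTerm-≤1 x v) 2≤sum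
        vu , xu = nbrTerm-positive x v u 1≤tu
        vw , xw = nbrTerm-positive x v w 1≤tw
    in u , w , u≢w , vu , vw , xu , xw

  nbrSum≡0⇒false : ∀ {x v u} → nbrSum G x v ≡ 0 → Adjacent G v u → x u ≡ false
  nbrSum≡0⇒false {x} {v} {u} sum≡0 vu with x u in xu
  ... | false = refl
  ... | true with () ← subst (1 ≤_) sum≡0 (nbr⇒nbrSum-positive vu xu)

  nbrSum-cong : ∀ {x y} → x ≗ y → ∀ v → nbrSum G x v ≡ nbrSum G y v
  nbrSum-cong x≗y v = sumFin-cong λ u → cong (λ b → if Adj G v u then ⟦ b ⟧ else 0) (x≗y u)

  Feasible-cong : ∀ {q q′ r r′} → q ≗ q′ → r ≗ r′ → Feasible G q r → Feasible G q′ r′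
  Feasible-cong {q} {q′} {r} {r′} q≗q′ r≗r′ (covered , r≤q) =
    (λ v → subst (2 ≤_) (sum≡ v) (covered v)) ,
    (λ v → subst₂ _≤_ (cong ⟦_⟧ (r≗r′ v)) (cong ⟦_⟧ (q≗q′ v)) (r≤q v))
    where
    sum≡ : ∀ v → 2 * ⟦ q v ⟧ + nbrSum G q v + nbrSum G r v ≡ 2 * ⟦ q′ v ⟧ + nbrSum G q′ v + nbrSum G r′ v
    sum≡ v = cong₂ _+_ (cong₂ _+_ (cong (λ b → 2 * ⟦ b ⟧) (q≗q′ v)) (nbrSum-cong q≗q′ v))
                       (nbrSum-cong r≗r′ v)

  objective-cong : ∀ {q q′ r r′ : Fin n → Bool} → q ≗ q′ → r ≗ r′ → objective q r ≡ objective q′ r′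
  objective-cong q≗q′ r≗r′ =
    cong₂ (λ a b → 2 * a + b) (sumFin-cong (cong ⟦_⟧ ∘ q≗q′)) (sumFin-cong (cong ⟦_⟧ ∘ r≗r′))

  Feasible? : ∀ q r → Dec (Feasible G q r)
  Feasible? q r = all? (λ v → 2 ≤? _) ×-dec all? (λ v → ⟦ r v ⟧ ≤? ⟦ q v ⟧)

  ILPValue? : ∀ k → Dec (ILPValue G k)
  ILPValue? k = map′ fromSubsets toSubsets
    (anySubset? λ s → anySubset? λ t →
      Feasible? (lookup s) (lookup t) ×-dec (objective (lookup s) (lookup t) ℕ.≟ k))
    where
    fromSubsets : (∃[ s ] ∃[ t ] (Feasible G (lookup s) (lookup t) × objective (lookup s) (lookup t) ≡ k)) →
                  ILPValue G k
    fromSubsets (s , t , feasible , obj) = lookup s , lookup t , feasible , obj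
    toSubsets : ILPValue G k →
                ∃[ s ] ∃[ t ] (Feasible G (lookup s) (lookup t) × objective (lookup s) (lookup t) ≡ k)
    toSubsets (q , r , feasible , obj) =
      tabulate q , tabulate r ,
      Feasible-cong (sym ∘ lookup∘tabulate q) (sym ∘ lookup∘tabulate r) feasible ,
      trans (objective-cong (lookup∘tabulate q) (lookup∘tabulate r)) obj

  allTrue-feasible : Feasible G (const true) (const true)
  allTrue-feasible = (λ v → ≤-trans (m≤m+n 2 (nbrSum G (const true) v)) (m≤m+n _ _)) , λ v → ≤-refl

  fromILP-isDRDF : ∀ {q r} → Feasible G q r → IsDRDF G (fromILP q r)
  fromILP-isDRDF {q} {r} (covered , r≤q) =
    (λ v → label≤3 (q v) (r v)) , defended , λ v fv≡1 → contradiction fv≡1 (label≢1 (r≤q v))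
    where
    defended : ∀ v → fromILP q r v ≡ 0 → Defended₀ G (fromILP q r) v
    defended v fv≡0 with nbrSum G r v in r-sum | covered v
    ... | suc _ | _ =
      let u , vu , ru = nbrSum-positive {r} (subst (1 ≤_) (sym r-sum) (s≤s z≤n))
      in inj₂ (u , vu , label≡3 (r≤q u) ru)
    ... | zero | 2≤cover =
      let u , w , u≢w , vu , vw , qu , qw = nbrSum-≥2 {q} 2≤q-sum
      in inj₁ (u , w , u≢w , vu , vw , label≡2 qu (nbrSum≡0⇒false r-sum vu)
                                     , label≡2 qw (nbrSum≡0⇒false r-sum vw))
      where
      2≤q-sum : 2 ≤ nbrSum G q v
      2≤q-sum = subst (2 ≤_)
        (trans (cong (λ b → 2 * ⟦ b ⟧ + nbrSum G q v + 0) (label≡0⇒false (q v) (r v) fv≡0))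
               (+-identityʳ _))
        2≤cover

  decode-feasible : ∀ {f} → IsDRDF G f → (∀ v → f v ≢ 1) →
                    Feasible G (λ v → 2 ≤ᵇ f v) (λ v → f v ≡ᵇ 3)
  decode-feasible {f} (_ , defended₀ , _) no-ones = covered , λ v → ≡ᵇ3≤≤ᵇ2 (f v)
    where
    q r : Fin n → Bool
    q v = 2 ≤ᵇ f v
    r v = f v ≡ᵇ 3
    covered : ∀ v → 2 ≤ 2 * ⟦ q v ⟧ + nbrSum G q v + nbrSum G r v
    covered v with f v in fv
    ... | 0 with defended₀ v fv
    ...   | inj₁ (u , w , u≢w , vu , vw , fu≡2 , fw≡2) =
      ≤-trans (nbrs⇒nbrSum-≥2 {q} u≢w vu vw (cong (2 ≤ᵇ_) fu≡2) (cong (2 ≤ᵇ_) fw≡2)) (m≤m+n _ _)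
    ...   | inj₂ (u , vu , fu≡3) =
      +-mono-≤ (nbr⇒nbrSum-positive {q} vu (cong (2 ≤ᵇ_) fu≡3))
               (nbr⇒nbrSum-positive {r} vu (cong (_≡ᵇ 3) fu≡3))
    covered v | 1           = contradiction fv (no-ones v)
    covered v | suc (suc _) = ≤-trans (m≤m+n 2 (nbrSum G q v)) (m≤m+n _ _)

  IsDRDF-retire-one : ∀ {f f′ v u} → IsDRDF G f → f v ≡ 1 →
                      f′ v ≡ 0 → Adjacent G v u → f′ u ≡ 3 →
                      (∀ w → w ≢ v → f′ w ≡ 3 ⊎ f′ w ≡ f w) → IsDRDF G f′
  IsDRDF-retire-one {f} {f′} {v} {u} (≤3 , defended₀ , defended₁) fv≡1 f′v≡0 vu f′u≡3 f′-off-v =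
    bounded , defended₀′ , defended₁′
    where
    changes : ∀ w → w ≡ v ⊎ f′ w ≡ 3 ⊎ f′ w ≡ f w
    changes w with w ≟ᶠ v
    ... | yes w≡v = inj₁ w≡v
    ... | no  w≢v = inj₂ (f′-off-v w w≢v)

    witness-kept : ∀ {x} → 2 ≤ f x → f′ x ≡ 3 ⊎ f′ x ≡ f x
    witness-kept {x} 2≤fx = f′-off-v x (≥2-≢-1 f 2≤fx fv≡1)

    bounded : ∀ w → f′ w ≤ 3
    bounded w with changes w
    ... | inj₁ refl         = ≤-trans (≤-reflexive f′v≡0) z≤n
    ... | inj₂ (inj₁ f′w≡3) = ≤-reflexive f′w≡3
    ... | inj₂ (inj₂ f′w≡fw) = ≤-trans (≤-reflexive f′w≡fw) (≤3 w)

    defended₀′ : ∀ w → f′ w ≡ 0 → Defended₀ G f′ w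
    defended₀′ w f′w≡0 with changes w
    ... | inj₁ refl          = inj₂ (u , vu , f′u≡3)
    ... | inj₂ (inj₁ f′w≡3)  = contradiction (trans (sym f′w≡3) f′w≡0) λ ()
    ... | inj₂ (inj₂ f′w≡fw) with defended₀ w (trans (sym f′w≡fw) f′w≡0)
    ...   | inj₂ (x , wx , fx≡3) with witness-kept {x} (subst (2 ≤_) (sym fx≡3) (s≤s (s≤s z≤n)))
    ...     | inj₁ f′x≡3 = inj₂ (x , wx , f′x≡3)
    ...     | inj₂ f′x≡fx = inj₂ (x , wx , trans f′x≡fx fx≡3)
    defended₀′ w f′w≡0 | inj₂ (inj₂ _) | inj₁ (x , y , x≢y , wx , wy , fx≡2 , fy≡2)
      with witness-kept {x} (≤-reflexive (sym fx≡2)) | witness-kept {y} (≤-reflexive (sym fy≡2))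
    ... | inj₁ f′x≡3  | _           = inj₂ (x , wx , f′x≡3)
    ... | inj₂ _      | inj₁ f′y≡3  = inj₂ (y , wy , f′y≡3)
    ... | inj₂ f′x≡fx | inj₂ f′y≡fy =
      inj₁ (x , y , x≢y , wx , wy , trans f′x≡fx fx≡2 , trans f′y≡fy fy≡2)

    defended₁′ : ∀ w → f′ w ≡ 1 → Defended₁ G f′ w
    defended₁′ w f′w≡1 with changes w
    ... | inj₁ refl          = contradiction (trans (sym f′v≡0) f′w≡1) λ ()
    ... | inj₂ (inj₁ f′w≡3)  = contradiction (trans (sym f′w≡3) f′w≡1) λ ()
    ... | inj₂ (inj₂ f′w≡fw) with defended₁ w (trans (sym f′w≡fw) f′w≡1)
    ...   | x , wx , 2≤fx with witness-kept 2≤fx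
    ...     | inj₁ f′x≡3  = x , wx , ≤-trans (s≤s (s≤s z≤n)) (≤-reflexive (sym f′x≡3))
    ...     | inj₂ f′x≡fx = x , wx , ≤-trans 2≤fx (≤-reflexive (sym f′x≡fx))

  reassign-isDRDF : ∀ {f v u} → IsDRDF G f → f v ≡ 1 → Adjacent G v u → 2 ≤ f u →
                    IsDRDF G (reassign f v u)
  reassign-isDRDF {f} {v} {u} drdf fv≡1 vu 2≤fu =
    IsDRDF-retire-one drdf fv≡1
      (trans (updateAt-minimal v u _ (u≢v ∘ sym)) (updateAt-updates v f))
      vu (updateAt-updates u _) off-v
    where
    u≢v : u ≢ v
    u≢v = ≥2-≢-1 f 2≤fu fv≡1
    off-v : ∀ w → w ≢ v → reassign f v u w ≡ 3 ⊎ reassign f v u w ≡ f w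
    off-v w w≢v with w ≟ᶠ u
    ... | yes refl = inj₁ (updateAt-updates u _)
    ... | no  w≢u  = inj₂ (trans (updateAt-minimal w u _ w≢u) (updateAt-minimal w v f w≢v))

  ILPValue⇒DRDFWeight : ∀ {k} → ILPValue G k → DRDFWeight G k
  ILPValue⇒DRDFWeight (q , r , feasible , obj) =
    fromILP q r , fromILP-isDRDF feasible , trans (weight-fromILP q r) obj

  DRDFWeight⇒ILPValue-below : ∀ {m} → DRDFWeight G m → ∃[ k ] (ILPValue G k × k ≤ m)
  DRDFWeight⇒ILPValue-below (f , drdf , refl) = <-rec Below descend (ones f) f refl drdf
    where
    Below : ℕ → Set
    Below c = ∀ f → ones f ≡ c → IsDRDF G f → ∃[ k ] (ILPValue G k × k ≤ weight f)
    descend : ∀ c → (∀ {c′} → c′ < c → Below c′) → Below c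
    descend _ below f refl drdf@(≤3 , _ , defended₁) with any? (λ v → f v ℕ.≟ 1)
    ... | no no-one =
      weight f ,
      ((λ v → 2 ≤ᵇ f v) , (λ v → f v ≡ᵇ 3) , decode-feasible drdf no-ones , objective-decode ≤3 no-ones) ,
      ≤-refl
      where
      no-ones : ∀ v → f v ≢ 1
      no-ones v fv≡1 = no-one (v , fv≡1)
    ... | yes (v , fv≡1) =
      let u , vu , 2≤fu = defended₁ v fv≡1
          k , ilpₖ , k≤ = below (ones-reassign f fv≡1 2≤fu) (reassign f v u) refl
                                (reassign-isDRDF drdf fv≡1 vu 2≤fu)
      in k , ilpₖ , ≤-trans k≤ (weight-reassign f fv≡1 2≤fu)

theorem5 : ∀ (n : ℕ) (G : SimpleGraph n) →
    ∃[ k ] (IsILPOptimum G k × IsDoubleRomanDominationNumber G k)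
theorem5 n G =
  let k , optimum = minimum (ILPValue? G) (const true , const true , allTrue-feasible G , refl)
  in k , optimum ,
     IsMinimum-transfer (ILPValue⇒DRDFWeight G) (DRDFWeight⇒ILPValue-below G) optimum
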